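{- Let $m>1$ be an odd integer. Then $I_r(\mathbb{Z}/2m\mathbb{Z})=I_r(\mathbb{Z}/m\mathbb{Z})$.
   Context: For a finite commutative ring $R$, $I_r(R)$ (the Erdős–Burgess constant of the multiplicative semigroup of $R$) is the smallest positive integer $t$ such that every sequence of $t$ (not necessarily distinct) elements of $R$ contains a nonempty subsequence whose elements multiply to an idempotent element of $R$ (an element $x$ with $x^2=x$). -}

module Defs where

open import Data.Nat using (ℕ; zero; suc; _*_; _≤_; NonZero)
open import Data.Nat.DivMod using (_%_; m%n<n)
open import Data.Fin using (Fin; toℕ; fromℕ<)
open import Data.Fin.Subset using (Subset; inside; outside; Nonempty)
open import Data.Vec using (Vec; []; _∷_)
open import Data.Product using (Σ; _×_; ∃)
open import Relation.Binary.PropositionalEquality using (_≡_)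

ZMod : ℕ → Set
ZMod n = Fin n

mulMod : (n : ℕ) .{{_ : NonZero n}} → ZMod n → ZMod n → ZMod n
mulMod n a b = fromℕ< (m%n<n (toℕ a * toℕ b) n)

oneMod : (n : ℕ) .{{_ : NonZero n}} → ZMod n
oneMod n = fromℕ< (m%n<n 1 n)

IsIdempotent : (n : ℕ) .{{_ : NonZero n}} → ZMod n → Set
IsIdempotent n x = mulMod n x x ≡ x

subProd : (n : ℕ) .{{_ : NonZero n}} → {t : ℕ} → Vec (ZMod n) t → Subset t → ZMod n
subProd n [] [] = oneMod n
subProd n (x ∷ xs) (inside ∷ s) = mulMod n x (subProd n xs s)
subProd n (x ∷ xs) (outside ∷ s) = subProd n xs s

EBProperty : (n : ℕ) .{{_ : NonZero n}} → ℕ → Set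
EBProperty n t = (xs : Vec (ZMod n) t) →
  Σ (Subset t) (λ s → Nonempty s × IsIdempotent n (subProd n xs s))

IsIr : (n : ℕ) .{{_ : NonZero n}} → ℕ → Set
IsIr n t = 1 ≤ t × EBProperty n t × ((s : ℕ) → 1 ≤ s → EBProperty n s → t ≤ s)

-- Every element x of ℤ/nℤ has an idempotent power x^e with 1 ≤ e ≤ n², so in a
-- sequence of length n³ + 1 some element occurs e times and those occurrences multiply
-- to an idempotent; the property is decidable, hence I_r(ℤ/nℤ) exists. For odd m,
-- ℤ/2mℤ ≅ ℤ/2 × ℤ/m and every element of ℤ/2 is idempotent, so y ∈ ℤ/2mℤ is
-- idempotent iff its reduction mod m is. As reduction is multiplicative and has a
-- section, a length has the property for 2m iff it has it for m.

module Submission where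

open import Defs
open import Level using (Level)
open import Data.Nat using (ℕ; zero; suc; _+_; _*_; _∸_; _≤_; _<_; z≤n; s≤s; s≤s⁻¹; NonZero; >-nonZero)
open import Data.Nat.Properties
  using (m*n≢0; +-0-commutativeMonoid; +-mono-≤; *-mono-≤; *-comm; *-assoc; *-identityˡ; +-identityʳ
        ; +-assoc; +-suc; *-distribʳ-∸; _≤?_; ≰⇒>; ≮⇒≥; <-irrefl; ≤-trans; ≤-reflexive; <⇒≤; <-≤-trans
        ; n≤1+n; n<1+n; m≤m*n; m≤n*m; m∸n≤m; m<n⇒0<n∸m; m+[n∸m]≡n; m∸n+n≡m; m+n∸m≡n
        ; [m+n]∸[m+o]≡n∸o; m≤n⇒m<n∨m≡n)
open import Data.Nat.DivMod
  using (_%_; _/_; m%n<n; %-distribˡ-*; m<n⇒m%n≡m; m≡m%n+[m/n]*n; %-remove-+ʳ; m∣n⇒o%n%m≡o%m)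
open import Data.Nat.Divisibility using (_∣_; divides; ∣m∣n⇒∣m+n; n∣m*n)
open import Data.Nat.Primality using (Prime; euclidsLemma; prime[2])
open import Data.Nat.Tactic.RingSolver using (solve-∀)
open import Algebra.Properties.CommutativeMonoid.Sum +-0-commutativeMonoid
  using (sum; ∑-distrib-+; sum-cong-≗; sum-replicate-zero)
open import Data.Bool using (if_then_else_; true; false)
open import Data.Fin using (Fin; toℕ; fromℕ<; inject≤) renaming (zero to fzero; suc to fsuc)
open import Data.Fin.Properties
  using (_≟_; toℕ-fromℕ<; toℕ-injective; toℕ<n; toℕ-inject≤; pigeonhole; all?; ¬∀⟶∃¬)
open import Data.Fin.Subset using (Subset; inside; outside; Nonempty; ⊥; ∣_∣)
open import Data.Fin.Subset.Properties using (nonempty?; anySubset?; Empty-unique; ∣⊥∣≡0)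
open import Data.Vec using (Vec; []; _∷_; map; count)
open import Data.Vec.Properties using (map-∘; map-cong; map-id)
open import Data.Product using (Σ; _×_; _,_; ∃; map₂)
open import Data.Sum using (inj₁; inj₂)
open import Function using (_∘_)
open import Function.Bundles using (_⇔_; mk⇔; Equivalence)
open import Relation.Nullary using (¬_; Dec; yes; no; does; contradiction)
open import Relation.Nullary.Decidable using (_×-dec_)
open import Relation.Unary using (Pred; Decidable)
open import Relation.Binary.PropositionalEquality

private variable
  ℓ : Level

least-satisfying : {P : Pred ℕ ℓ} → Decidable P → ∀ {T} → P T → ∃ λ t → P t × (∀ s → P s → t ≤ s)
least-satisfying {P = P} P? {T} pT = search 0 T (λ _ ()) pT
  where
  search : ∀ k r → (∀ s → s < k → ¬ P s) → P (k + r) → ∃ λ t → P t × (∀ s → P s → t ≤ s)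
  search k r none-below p with P? k
  ... | yes pk = k , pk , λ s ps → ≮⇒≥ λ s<k → none-below s s<k ps
  search k zero    none-below p | no ¬pk = contradiction (subst P (+-identityʳ k) p) ¬pk
  search k (suc r) none-below p | no ¬pk = search (suc k) r none-below′ (subst P (+-suc k r) p)
    where
    none-below′ : ∀ s → s < suc k → ¬ P s
    none-below′ s s<1+k with m≤n⇒m<n∨m≡n (s≤s⁻¹ s<1+k)
    ... | inj₁ s<k  = none-below s s<k
    ... | inj₂ refl = ¬pk

all-vectors? : ∀ {n t} {P : Pred (Vec (Fin n) t) ℓ} → Decidable P → Dec (∀ xs → P xs)
all-vectors? {t = zero} P? with P? []
... | yes p = yes λ { [] → p }
... | no ¬p = no λ ∀P → ¬p (∀P [])
all-vectors? {t = suc t} P? with all? (λ x → all-vectors? (P? ∘ (x ∷_)))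
... | yes ∀P = yes λ { (x ∷ xs) → ∀P x xs }
... | no ¬∀P = no λ ∀P → ¬∀P λ x xs → ∀P (x ∷ xs)

indicator : ∀ {n} → Fin n → Fin n → ℕ
indicator x y = if does (x ≟ y) then 1 else 0

sum-indicator : ∀ {n} (y : Fin n) → sum (λ x → indicator x y) ≡ 1
sum-indicator {suc n} fzero    = cong suc (sum-replicate-zero n)
sum-indicator {suc n} (fsuc y) = sum-indicator y

count-∷ : ∀ {n t} (x y : Fin n) (ys : Vec (Fin n) t) →
          count (x ≟_) (y ∷ ys) ≡ indicator x y + count (x ≟_) ys
count-∷ x y ys with does (x ≟ y)
... | true  = refl
... | false = refl

sum-count : ∀ {n t} (xs : Vec (Fin n) t) → sum (λ x → count (x ≟_) xs) ≡ t
sum-count {n} [] = sum-replicate-zero n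
sum-count {n} {suc t} (y ∷ ys) = begin
  sum (λ x → count (x ≟_) (y ∷ ys))             ≡⟨ sum-cong-≗ (λ x → count-∷ x y ys) ⟩
  sum (λ x → indicator x y + occurrences x)     ≡⟨ ∑-distrib-+ (λ x → indicator x y) occurrences ⟩
  sum (λ x → indicator x y) + sum occurrences   ≡⟨ cong₂ _+_ (sum-indicator y) (sum-count ys) ⟩
  suc t                                         ∎
  where
  open ≡-Reasoning
  occurrences : Fin n → ℕ
  occurrences x = count (x ≟_) ys

sum-≤ : ∀ {n} (f : Fin n → ℕ) {b} → (∀ i → f i ≤ b) → sum f ≤ n * b
sum-≤ {zero}  f f≤b = z≤n
sum-≤ {suc n} f f≤b = +-mono-≤ (f≤b fzero) (sum-≤ (f ∘ fsuc) (f≤b ∘ fsuc))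

pigeonhole-count : ∀ {n t} k (xs : Vec (Fin n) t) → n * k < t → ∃ λ x → k < count (x ≟_) xs
pigeonhole-count {n} k xs nk<t
  with ¬∀⟶∃¬ n (λ x → count (x ≟_) xs ≤ k) (λ x → count (x ≟_) xs ≤? k) not-all-few
  where
  not-all-few : ¬ (∀ x → count (x ≟_) xs ≤ k)
  not-all-few all-few =
    <-irrefl refl (<-≤-trans nk<t (≤-trans (≤-reflexive (sym (sum-count xs))) (sum-≤ _ all-few)))
... | x , count≰k = x , ≰⇒> count≰k

0<∣p∣⇒nonempty : ∀ {t} (s : Subset t) → 1 ≤ ∣ s ∣ → Nonempty s
0<∣p∣⇒nonempty {t} s 1≤∣s∣ with nonempty? s
... | yes ne    = ne
... | no empty with () ← subst (1 ≤_) (trans (cong ∣_∣ (Empty-unique empty)) (∣⊥∣≡0 t)) 1≤∣s∣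

[m+n]%o≡m%o⇒o∣n : ∀ m n o .{{_ : NonZero o}} → (m + n) % o ≡ m % o → o ∣ n
[m+n]%o≡m%o⇒o∣n m n o eq = divides (q ∸ q′) (begin
  n                                     ≡⟨ m+n∸m≡n m n ⟨
  (m + n) ∸ m                           ≡⟨ cong₂ _∸_ (m≡m%n+[m/n]*n (m + n) o) (m≡m%n+[m/n]*n m o) ⟩
  ((m + n) % o + q * o) ∸ (m % o + q′ * o) ≡⟨ cong (λ r → (r + q * o) ∸ (m % o + q′ * o)) eq ⟩
  (m % o + q * o) ∸ (m % o + q′ * o)    ≡⟨ [m+n]∸[m+o]≡n∸o (m % o) (q * o) (q′ * o) ⟩
  q * o ∸ q′ * o                        ≡⟨ *-distribʳ-∸ o q q′ ⟨
  (q ∸ q′) * o                          ∎)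
  where
  open ≡-Reasoning
  q q′ : ℕ
  q  = (m + n) / o
  q′ = m / o

∣∧prime∣⇒*∣ : ∀ {p m k} → Prime p → ¬ p ∣ m → m ∣ k → p ∣ k → p * m ∣ k
∣∧prime∣⇒*∣ {p} {m} p-prime p∤m (divides q refl) p∣qm with euclidsLemma q m p-prime p∣qm
... | inj₁ (divides r refl) = divides r (*-assoc r p m)
... | inj₂ p∣m              = contradiction p∣m p∤m

2∣n*[1+n] : ∀ n → 2 ∣ n * suc n
2∣n*[1+n] zero    = divides 0 refl
2∣n*[1+n] (suc n) = subst (2 ∣_) (expand n) (∣m∣n⇒∣m+n (2∣n*[1+n] n) (divides (suc n) (*-comm 2 (suc n))))
  where
  expand : ∀ n → n * suc n + 2 * suc n ≡ suc n * suc (suc n)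
  expand = solve-∀

module Arithmetic (n : ℕ) .{{_ : NonZero n}} where

  infixl 7 _·_
  infixr 8 _^_

  _·_ : ZMod n → ZMod n → ZMod n
  _·_ = mulMod n

  residue : ℕ → ZMod n
  residue x = fromℕ< (m%n<n x n)

  toℕ-residue : ∀ x → toℕ (residue x) ≡ x % n
  toℕ-residue x = toℕ-fromℕ< (m%n<n x n)

  residue-cong : ∀ {x y} → x % n ≡ y % n → residue x ≡ residue y
  residue-cong {x} {y} eq = toℕ-injective (trans (toℕ-residue x) (trans eq (sym (toℕ-residue y))))

  residue-toℕ : ∀ a → residue (toℕ a) ≡ a
  residue-toℕ a = toℕ-injective (trans (toℕ-residue (toℕ a)) (m<n⇒m%n≡m (toℕ<n a)))

  residue-* : ∀ x y → residue (x * y) ≡ residue x · residue y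
  residue-* x y = residue-cong (begin
    x * y % n                                       ≡⟨ %-distribˡ-* x y n ⟩
    (x % n) * (y % n) % n                           ≡⟨ cong₂ (λ u v → u * v % n) (toℕ-residue x) (toℕ-residue y) ⟨
    toℕ (residue x) * toℕ (residue y) % n           ∎)
    where open ≡-Reasoning

  ·-assoc : ∀ a b c → (a · b) · c ≡ a · (b · c)
  ·-assoc a b c = begin
    (a · b) · c                                     ≡⟨ cong (a · b ·_) (residue-toℕ c) ⟨
    residue (toℕ a * toℕ b) · residue (toℕ c)       ≡⟨ residue-* (toℕ a * toℕ b) (toℕ c) ⟨
    residue (toℕ a * toℕ b * toℕ c)                 ≡⟨ cong residue (*-assoc (toℕ a) (toℕ b) (toℕ c)) ⟩
    residue (toℕ a * (toℕ b * toℕ c))               ≡⟨ residue-* (toℕ a) (toℕ b * toℕ c) ⟩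
    residue (toℕ a) · residue (toℕ b * toℕ c)       ≡⟨ cong (λ z → z · (b · c)) (residue-toℕ a) ⟩
    a · (b · c)                                     ∎
    where open ≡-Reasoning

  ·-identityˡ : ∀ a → oneMod n · a ≡ a
  ·-identityˡ a = begin
    residue 1 · a                                   ≡⟨ cong (residue 1 ·_) (residue-toℕ a) ⟨
    residue 1 · residue (toℕ a)                     ≡⟨ residue-* 1 (toℕ a) ⟨
    residue (1 * toℕ a)                             ≡⟨ cong residue (*-identityˡ (toℕ a)) ⟩
    residue (toℕ a)                                 ≡⟨ residue-toℕ a ⟩
    a                                               ∎
    where open ≡-Reasoning

  _^_ : ZMod n → ℕ → ZMod n
  x ^ zero  = oneMod n
  x ^ suc k = x · x ^ k

  ^-+ : ∀ x i j → x ^ (i + j) ≡ x ^ i · x ^ j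
  ^-+ x zero    j = sym (·-identityˡ (x ^ j))
  ^-+ x (suc i) j = trans (cong (x ·_) (^-+ x i j)) (sym (·-assoc x (x ^ i) (x ^ j)))

  module _ (x : ZMod n) {a d : ℕ} (cycle : x ^ (a + d) ≡ x ^ a) where

    ^-shift : ∀ r → x ^ (r + a + d) ≡ x ^ (r + a)
    ^-shift r = begin
      x ^ (r + a + d)                               ≡⟨ cong (x ^_) (+-assoc r a d) ⟩
      x ^ (r + (a + d))                             ≡⟨ ^-+ x r (a + d) ⟩
      x ^ r · x ^ (a + d)                           ≡⟨ cong (x ^ r ·_) cycle ⟩
      x ^ r · x ^ a                                 ≡⟨ ^-+ x r a ⟨
      x ^ (r + a)                                   ∎
      where open ≡-Reasoning

    ^-periodic : ∀ c r → x ^ (r + a + c * d) ≡ x ^ (r + a)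
    ^-periodic zero    r = cong (x ^_) (+-identityʳ (r + a))
    ^-periodic (suc c) r = begin
      x ^ (r + a + suc c * d)                       ≡⟨ cong (x ^_) (regroup r a c d) ⟩
      x ^ (r + c * d + a + d)                       ≡⟨ ^-shift (r + c * d) ⟩
      x ^ (r + c * d + a)                           ≡⟨ cong (x ^_) (swap r a (c * d)) ⟩
      x ^ (r + a + c * d)                           ≡⟨ ^-periodic c r ⟩
      x ^ (r + a)                                   ∎
      where
      open ≡-Reasoning
      regroup : ∀ r a c d → r + a + suc c * d ≡ r + c * d + a + d
      regroup = solve-∀
      swap : ∀ r a b → r + b + a ≡ r + a + b
      swap = solve-∀

  -- Pigeonhole on x⁰, …, xⁿ gives x^(a + d) = x^a with a < a + d ≤ n; then
  -- e = (a + 1) d is a multiple of the period beyond the preperiod.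
  idempotent-power : ∀ x → ∃ λ e → 1 ≤ e × e ≤ n * n × IsIdempotent n (x ^ e)
  idempotent-power x
    with i , j , i<j , xⁱ≡xʲ ← pigeonhole (n<1+n n) (λ (i : Fin (suc n)) → x ^ toℕ i)
    = e , *-mono-≤ {1} {suc a} (s≤s z≤n) 1≤d , *-mono-≤ (≤-trans i<j j≤n) (≤-trans (m∸n≤m (toℕ j) a) j≤n)
    , xᵉ-idem
    where
    a = toℕ i
    d = toℕ j ∸ a
    e = suc a * d
    j≤n : toℕ j ≤ n
    j≤n = s≤s⁻¹ (toℕ<n j)
    1≤d : 1 ≤ d
    1≤d = m<n⇒0<n∸m i<j
    cycle : x ^ (a + d) ≡ x ^ a
    cycle = trans (cong (x ^_) (m+[n∸m]≡n (<⇒≤ i<j))) (sym xⁱ≡xʲ)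
    e∸a+a≡e : e ∸ a + a ≡ e
    e∸a+a≡e = m∸n+n≡m (≤-trans (n≤1+n a) (m≤m*n (suc a) d {{>-nonZero 1≤d}}))
    xᵉ-idem : x ^ e · x ^ e ≡ x ^ e
    xᵉ-idem = begin
      x ^ e · x ^ e                                 ≡⟨ ^-+ x e e ⟨
      x ^ (e + e)                                   ≡⟨ cong (λ k → x ^ (k + e)) e∸a+a≡e ⟨
      x ^ (e ∸ a + a + suc a * d)                   ≡⟨ ^-periodic x cycle (suc a) (e ∸ a) ⟩
      x ^ (e ∸ a + a)                               ≡⟨ cong (x ^_) e∸a+a≡e ⟩
      x ^ e                                         ∎
      where open ≡-Reasoning

  subProd-⊥ : ∀ {t} (xs : Vec (ZMod n) t) → subProd n xs ⊥ ≡ oneMod n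
  subProd-⊥ []       = refl
  subProd-⊥ (x ∷ xs) = subProd-⊥ xs

  select-copies : ∀ {t} x (xs : Vec (ZMod n) t) k → k ≤ count (x ≟_) xs →
                  ∃ λ s → ∣ s ∣ ≡ k × subProd n xs s ≡ x ^ k
  select-copies {t} x xs zero _ = ⊥ , ∣⊥∣≡0 t , subProd-⊥ xs
  select-copies x (y ∷ ys) (suc k) k<count with x ≟ y
  ... | yes refl with s , ∣s∣≡k , prod ← select-copies x ys k (s≤s⁻¹ k<count)
    = inside ∷ s , cong suc ∣s∣≡k , cong (x ·_) prod
  ... | no _ with s , ∣s∣≡k , prod ← select-copies x ys (suc k) k<count
    = outside ∷ s , ∣s∣≡k , prod

  ebProperty-1+n³ : EBProperty n (suc (n * (n * n)))
  ebProperty-1+n³ xs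
    with x , n²<count ← pigeonhole-count (n * n) xs (n<1+n _)
    with e , 1≤e , e≤n² , xᵉ-idem ← idempotent-power x
    with s , ∣s∣≡e , prod ← select-copies x xs e (≤-trans e≤n² (<⇒≤ n²<count))
    = s , 0<∣p∣⇒nonempty s (subst (1 ≤_) (sym ∣s∣≡e) 1≤e) , subst (IsIdempotent n) (sym prod) xᵉ-idem

  ebProperty? : ∀ t → Dec (EBProperty n t)
  ebProperty? t = all-vectors? λ xs → anySubset? λ s →
    nonempty? s ×-dec (subProd n xs s · subProd n xs s ≟ subProd n xs s)

  least-ebLength : ∃ λ t → (1 ≤ t × EBProperty n t) × (∀ s → 1 ≤ s × EBProperty n s → t ≤ s)
  least-ebLength = least-satisfying (λ s → 1 ≤? s ×-dec ebProperty? s) (s≤s z≤n , ebProperty-1+n³)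

  -- Not via 'with': abstracting over least-ebLength makes the checker normalise the search.
  isIr-exists : ∃ (IsIr n)
  isIr-exists = map₂ (λ ((1≤t , eb) , least) → 1≤t , eb , λ s 1≤s eb-s → least s (1≤s , eb-s)) least-ebLength

open Arithmetic using (residue; toℕ-residue; residue-cong; residue-toℕ; residue-*; isIr-exists)

isIr-transfer : ∀ {m n t} .{{_ : NonZero m}} .{{_ : NonZero n}} →
                (∀ s → EBProperty m s ⇔ EBProperty n s) → IsIr m t → IsIr n t
isIr-transfer eb⇔ (1≤t , eb , least) =
  1≤t , Equivalence.to (eb⇔ _) eb , λ s 1≤s eb-s → least s 1≤s (Equivalence.from (eb⇔ s) eb-s)

module Doubling (m : ℕ) .{{_ : NonZero m}} (m-odd : ¬ 2 ∣ m) where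

  instance
    2m≢0 : NonZero (2 * m)
    2m≢0 = m*n≢0 2 m

  reduce : ZMod (2 * m) → ZMod m
  reduce a = residue m (toℕ a)

  lift : ZMod m → ZMod (2 * m)
  lift a = inject≤ a (m≤n*m m 2)

  reduce-lift : ∀ a → reduce (lift a) ≡ a
  reduce-lift a = trans (cong (residue m) (toℕ-inject≤ a _)) (residue-toℕ m a)

  reduce-residue : ∀ x → reduce (residue (2 * m) x) ≡ residue m x
  reduce-residue x = residue-cong m
    (trans (cong (_% m) (toℕ-residue (2 * m) x)) (m∣n⇒o%n%m≡o%m m (2 * m) x (n∣m*n 2)))

  reduce-· : ∀ a b → reduce (mulMod (2 * m) a b) ≡ mulMod m (reduce a) (reduce b)
  reduce-· a b = trans (reduce-residue (toℕ a * toℕ b)) (residue-* m (toℕ a) (toℕ b))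

  reduce-subProd : ∀ {t} (xs : Vec (ZMod (2 * m)) t) s →
                   reduce (subProd (2 * m) xs s) ≡ subProd m (map reduce xs) s
  reduce-subProd []       []            = reduce-residue 1
  reduce-subProd (x ∷ xs) (inside ∷ s)  =
    trans (reduce-· x _) (cong (mulMod m (reduce x)) (reduce-subProd xs s))
  reduce-subProd (x ∷ xs) (outside ∷ s) = reduce-subProd xs s

  -- Writing y = w + 1, y² − y = w (w + 1) is even, so m ∣ y² − y already gives 2m ∣ y² − y.
  square≡self-mod-2m : ∀ y → y < 2 * m → y * y % m ≡ y % m → y * y % (2 * m) ≡ y
  square≡self-mod-2m zero    y<2m _     = m<n⇒m%n≡m y<2m
  square≡self-mod-2m (suc w) y<2m sq≡y = trans
    (%-remove-+ʳ (suc w) (∣∧prime∣⇒*∣ prime[2] m-odd m∣w[w+1] (2∣n*[1+n] w)))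
    (m<n⇒m%n≡m y<2m)
    where
    m∣w[w+1] : m ∣ w * suc w
    m∣w[w+1] = [m+n]%o≡m%o⇒o∣n (suc w) (w * suc w) m sq≡y

  idempotent-reduce : ∀ y → IsIdempotent (2 * m) y → IsIdempotent m (reduce y)
  idempotent-reduce y idem = trans (sym (reduce-· y y)) (cong reduce idem)

  idempotent-lift : ∀ y → IsIdempotent m (reduce y) → IsIdempotent (2 * m) y
  idempotent-lift y idem =
    toℕ-injective (trans (toℕ-residue (2 * m) _) (square≡self-mod-2m (toℕ y) (toℕ<n y) square≡self-mod-m))
    where
    open ≡-Reasoning
    square≡self-mod-m : toℕ y * toℕ y % m ≡ toℕ y % m
    square≡self-mod-m = begin
      toℕ y * toℕ y % m                     ≡⟨ toℕ-residue m _ ⟨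
      toℕ (residue m (toℕ y * toℕ y))       ≡⟨ cong toℕ (reduce-residue _) ⟨
      toℕ (reduce (mulMod (2 * m) y y))     ≡⟨ cong toℕ (trans (reduce-· y y) idem) ⟩
      toℕ (reduce y)                        ≡⟨ toℕ-residue m (toℕ y) ⟩
      toℕ y % m                             ∎

  ebProperty-doubling : ∀ t → EBProperty m t ⇔ EBProperty (2 * m) t
  ebProperty-doubling t = mk⇔ up down
    where
    up : EBProperty m t → EBProperty (2 * m) t
    up eb xs with s , ne , idem ← eb (map reduce xs)
      = s , ne , idempotent-lift _ (subst (IsIdempotent m) (sym (reduce-subProd xs s)) idem)
    down : EBProperty (2 * m) t → EBProperty m t
    down eb xs with s , ne , idem ← eb (map lift xs)
      = s , ne , subst (λ v → IsIdempotent m (subProd m v s)) reduce∘lift≡id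
                       (subst (IsIdempotent m) (reduce-subProd (map lift xs) s) (idempotent-reduce _ idem))
      where
      reduce∘lift≡id : map reduce (map lift xs) ≡ xs
      reduce∘lift≡id = trans (sym (map-∘ reduce lift xs)) (trans (map-cong reduce-lift xs) (map-id xs))

open Doubling using (ebProperty-doubling)

theorem1p6 : (m : ℕ) .{{_ : NonZero m}} → 1 < m → ¬ (2 ∣ m) →
    Σ ℕ (λ t → IsIr m t × IsIr (2 * m) {{m*n≢0 2 m}} t)
theorem1p6 m _ m-odd =
  map₂ (λ isIr → isIr , isIr-transfer {{_}} {{m*n≢0 2 m}} (ebProperty-doubling m m-odd) isIr) (isIr-exists m)
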